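{- Let $G=(V,E)$ be a directed graph with $V=\{1,\dots,n\}$, $\beta\in(0,1)$, and let $A,b$ be the constraint matrix and right-hand side of $\mathcal{H}_\beta(G)$ defined below. Let $B\subseteq E$ with $\lvert B\rvert=n+1$, and let $H=(V,B)$ have connected components $H_1,\dots,H_m$, $H_k=(V_k,B_k)$, with $1\in V_1$. If $A_B$ is invertible and $x=A_B^{ -1}b$ (a vector indexed by $B$), then (i) $\lvert B_1\rvert=\lvert V_1\rvert+1$ and $\lvert B_k\rvert=\lvert V_k\rvert$ for $k=2,\dots,m$; (ii) $x_{ij}=0$ for every $(i,j)\in B\setminus B_\rho$, where $B_\rho$ is the arc set of $\rho(H_1)$.
   Context: $G=(V,E)$ is a directed graph without loops or multiple arcs; $\mathcal{N}^{+}(i)=\{j:(i,j)\in E\}$, $\mathcal{N}^{ - }(i)=\{j:(j,i)\in E\}$. $\mathcal{H}_\beta(G)\subseteq\mathbb{R}^E$ is defined by $\sum_{j\in\mathcal{N}^{+}(1)}x_{1j}-\beta\sum_{j\in\mathcal{N}^{ - }(1)}x_{j1}=1-\beta^n$; $\sum_{j\in\mathcal{N}^{+}(i)}x_{ij}-\beta\sum_{j\in\mathcal{N}^{ - }(i)}x_{ji}=0$ for $i\in V\setminus\{1\}$; $\sum_{j\in\mathcal{N}^{+}(1)}x_{1j}=1$; $x\ge0$. $A$ is the $(n+1)\times\lvert E\rvert$ matrix of the $n+1$ equalities (columns indexed by arcs), $b=(1-\beta^n,0,\dots,0,1)^T$ its right-hand side, and $A_B$ the square submatrix of columns indexed by $B$.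 Connected components are in the underlying undirected sense. $\rho(H_1)$ is the subgraph of $H_1$ obtained by repeatedly removing nodes of (total) degree 1 together with their incident arc, until no node of degree 1 remains. -}

module Defs where

open import Level using (Level; _⊔_) renaming (suc to lsuc)
open import Data.Nat as ℕ using (ℕ; zero; suc)
open import Data.Fin as Fin using (Fin; zero; suc; inject₁; fromℕ)
open import Data.Fin.Subset using (Subset; _∈_; _∉_)
open import Data.Fin.Subset.Properties using (_∈?_)
open import Data.Product using (Σ; ∃; _×_; _,_; proj₁; proj₂)
open import Data.Sum using (_⊎_)
open import Data.Bool using (Bool; true; false; if_then_else_; _∧_)
open import Relation.Nullary using (¬_; Dec; does)
open import Relation.Binary using (Rel; IsStrictTotalOrder)
open import Relation.Binary.PropositionalEquality using (_≡_)
open import Relation.Binary.Construct.Closure.ReflexiveTransitive using (Star)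
open import Algebra.Bundles using (CommutativeRing)
open import Function.Bundles using (_⇔_)

-- Ordered fields (ℝ is an instance).  The stdlib has no reals; the
-- statement is purely linear-algebraic, so we state it over an
-- arbitrary ordered field, in which β ranges over (0,1).

record OrderedField (c ℓ : Level) : Set (lsuc (c ⊔ ℓ)) where
  field
    commRing : CommutativeRing c ℓ
  open CommutativeRing commRing public
  field
    _<_           : Rel Carrier ℓ
    isStrictTotalOrder : IsStrictTotalOrder _≈_ _<_
    0≉1           : ¬ (0# ≈ 1#)
    inverse       : ∀ x → ¬ (x ≈ 0#) → ∃ λ y → x * y ≈ 1#
    +-mono-<      : ∀ {a b} c → a < b → (a + c) < (b + c)
    *-pos         : ∀ {a b} → 0# < a → 0# < b → 0# < (a * b)

count : ∀ {m} → (Fin m → Bool) → ℕ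
count {zero}  p = 0
count {suc m} p = (if p zero then 1 else 0) ℕ.+ count (λ k → p (suc k))

Arc : ℕ → Set
Arc n = Fin n × Fin n

tail head : ∀ {n} → Arc n → Fin n
tail = proj₁
head = proj₂

-- An arc family B : Fin (suc n) → Arc n (|B| = n+1 arcs, indexed by Fin (suc n)).

Adj : ∀ {n m} → (Fin m → Arc n) → Fin n → Fin n → Set
Adj B u v = ∃ λ k → (B k ≡ (u , v)) ⊎ (B k ≡ (v , u))

Conn : ∀ {n m} → (Fin m → Arc n) → Fin n → Fin n → Set
Conn B = Star (Adj B)

IsComponentOf : ∀ {n m} → (Fin m → Arc n) → Fin n → Subset n → Set
IsComponentOf B v S = ∀ w → (w ∈ S) ⇔ Conn B v w

-- Arcs of H (indices in Fin m) whose tail lies in S: for a component S,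
-- these are exactly the arcs of that component.
arcsIn : ∀ {n m} → (Fin m → Arc n) → Subset n → Fin m → Bool
arcsIn B S k = does (tail (B k) ∈? S)

degree : ∀ {n m} → (Fin m → Arc n) → Subset m → Fin n → ℕ
degree B R w =
  count (λ k → does (k ∈? R) ∧ does (tail (B k) Fin.≟ w))
  ℕ.+ count (λ k → does (k ∈? R) ∧ does (head (B k) Fin.≟ w))

data LeafStep {n m} (B : Fin m → Arc n) : Subset m → Subset m → Set where
  remove : ∀ {R R'} (w : Fin n) (k : Fin m) →
           degree B R w ≡ 1 → k ∈ R →
           (tail (B k) ≡ w ⊎ head (B k) ≡ w) →
           (∀ j → (j ∈ R') ⇔ ((j ∈ R) × ¬ (j ≡ k))) →
           LeafStep B R R'

IsRho : ∀ {n m} → (Fin m → Arc n) → Subset m → Subset m → Set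
IsRho B R₁ Rρ = Star (LeafStep B) R₁ Rρ × (∀ w → ¬ (degree B Rρ w ≡ 1))

-- The constraint matrix A restricted to the columns B, and b.
-- Rows: inject₁ v for the flow equation of vertex v (vertex 1 = zero),
-- and fromℕ n for the extra equation  Σ_{j∈N⁺(1)} x_{1j} = 1.

module _ {c ℓ} (F : OrderedField c ℓ) where
  open OrderedField F hiding (zero)

  _^_ : Carrier → ℕ → Carrier
  x ^ zero  = 1#
  x ^ suc k = x * (x ^ k)

  indicator : Bool → Carrier → Carrier
  indicator t a = if t then a else 0#

  -- Here the graph has n = suc p vertices Fin (suc p); vertex 1 is zero.
  Aentry : ∀ {p} → Carrier → Fin (suc (suc p)) → Arc (suc p) → Carrier
  Aentry {p} β r (u , v) =
    if does (r Fin.≟ fromℕ (suc p))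
    then indicator (does (u Fin.≟ zero)) 1#
    else (indicator (does (r Fin.≟ inject₁ u)) 1#
          - indicator (does (r Fin.≟ inject₁ v)) β)

  A[_] : ∀ {p} → Carrier → (Fin (suc (suc p)) → Arc (suc p)) →
         Fin (suc (suc p)) → Fin (suc (suc p)) → Carrier
  A[ β ] B r k = Aentry β r (B k)

  bvec : ∀ {p} → Carrier → Fin (suc (suc p)) → Carrier
  bvec {p} β r =
    if does (r Fin.≟ fromℕ (suc p)) then 1#
    else (if does (r Fin.≟ zero) then 1# - (β ^ suc p) else 0#)

  open import Algebra.Properties.Monoid.Sum +-monoid using (sum)

  _·_ : ∀ {m} → (Fin m → Fin m → Carrier) → (Fin m → Fin m → Carrier) →
        Fin m → Fin m → Carrier
  (M · N) i j = sum (λ k → M i k * N k j)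

  I : ∀ {m} → Fin m → Fin m → Carrier
  I i j = if does (i Fin.≟ j) then 1# else 0#

  _·ᵥ_ : ∀ {m} → (Fin m → Fin m → Carrier) → (Fin m → Carrier) → Fin m → Carrier
  (M ·ᵥ y) i = sum (λ k → M i k * y k)

  IsInverse : ∀ {m} → (Fin m → Fin m → Carrier) → (Fin m → Fin m → Carrier) → Set ℓ
  IsInverse M N = (∀ i j → (N · M) i j ≈ I i j) × (∀ i j → (M · N) i j ≈ I i j)

vertex1 : ∀ {p} → Fin (suc p)
vertex1 = zero

module Submission where

open import Defs
open import Data.Nat as ℕ using (ℕ; zero; suc; _≤_; z≤n; s≤s)
import Data.Nat.Properties as ℕₚ
open import Data.Fin as Fin using (Fin; zero; suc; inject₁; fromℕ)
import Data.Fin.Properties as Finₚ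
open import Data.Fin.Relation.Unary.Top using (View; view; ‵fromℕ; ‵inj₁; ‵inject₁; view-fromℕ; view-inject₁)
open import Data.Fin.Subset using (Subset; ∣_∣; _∈_; _∉_)
open import Data.Fin.Subset.Properties using (_∈?_)
open import Data.Vec using (tabulate; []; _∷_)
import Data.Vec.Properties as Vecₚ
open import Data.List using (List)
open import Data.List.Membership.Propositional using () renaming (_∈_ to _∈ₗ_)
open import Data.List.Relation.Unary.Unique.Propositional using (Unique)
open import Data.Product using (_×_; _,_; proj₁; proj₂)
open import Data.Sum using (_⊎_; inj₁; inj₂)
open import Data.Bool using (Bool; true; false; if_then_else_; not; _∧_)
open import Data.Bool.Properties using (¬-not; not-¬)
open import Data.Empty using (⊥-elim)
open import Function using (_∘_)
open import Function.Bundles using (Equivalence; mk⇔)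
open import Function.Definitions using (Injective)
open import Relation.Nullary using (¬_; Dec; yes; no; does)
open import Relation.Nullary.Decidable using (dec-true; dec-false; does-⇔)
open import Relation.Binary using (IsStrictTotalOrder)
open import Relation.Binary.Definitions using (tri<; tri≈; tri>)
open import Relation.Binary.PropositionalEquality using (_≡_; _≢_)
import Relation.Binary.PropositionalEquality as ≡
open import Relation.Binary.Construct.Closure.ReflexiveTransitive using (Star; ε; _◅_; _◅◅_; reverse)

-- Both parts rest on the block structure of A_B with respect to a union σ
-- of connected components of H = (V, B): a column (arc) with tail in σ has
-- nonzero entries only in the flow rows of vertices of σ and, when 1 ∈ σ,
-- in the extra row Σ x₁ⱼ = 1.  For an invertible matrix A with inverse M
-- that is block diagonal in this sense, (1) the blocks are square, since
-- trace(D_P·M·A) = trace(D_Q·A·M) for the diagonal projections D_P, D_Q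
-- onto the column and row blocks and an ordered field has characteristic
-- zero; and (2) M maps a vector vanishing on the rows of a block to one
-- vanishing on its columns.  Applying (1) to single components gives
-- part (i); applying (2) to the complement of H₁, where b = 0, shows that x
-- vanishes off H₁.  Part (ii) follows because removing a leaf preserves this
-- support property: the row equations at the leaf force its arc to be 0.
-- The file treats counting, graphs, ordered fields, block matrices and the
-- entries of A_B and b in turn, and derives the theorem at the end.

bit : Bool → ℕ
bit t = if t then 1 else 0

count-cong : ∀ {m} {f g : Fin m → Bool} → (∀ i → f i ≡ g i) → count f ≡ count g
count-cong {zero}  f≗g = ≡.refl
count-cong {suc m} f≗g = ≡.cong₂ (λ t n → bit t ℕ.+ n) (f≗g zero) (count-cong (f≗g ∘ suc))

count-last : ∀ {m} (f : Fin (suc m) → Bool) →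
  count f ≡ count (f ∘ inject₁) ℕ.+ bit (f (fromℕ m))
count-last {zero}  f = ℕₚ.+-comm (bit (f zero)) 0
count-last {suc m} f = ≡.trans (≡.cong (bit (f zero) ℕ.+_) (count-last (f ∘ suc)))
  (≡.sym (ℕₚ.+-assoc (bit (f zero)) (count (f ∘ suc ∘ inject₁)) (bit (f (fromℕ (suc m))))))

member : ∀ {n} → Subset n → Fin n → Bool
member S u = does (u ∈? S)

count-∈ : ∀ {n} (S : Subset n) → count (member S) ≡ ∣ S ∣
count-∈ [] = ≡.refl
count-∈ (true ∷ S) = ≡.cong suc (count-∈ S)
count-∈ (false ∷ S) = count-∈ S

count-≥1 : ∀ {m} (f : Fin m → Bool) i → f i ≡ true → 1 ≤ count f
count-≥1 f zero    fi rewrite fi = s≤s z≤n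
count-≥1 f (suc i) fi = ℕₚ.≤-trans (count-≥1 (f ∘ suc) i fi) (ℕₚ.m≤n+m (count (f ∘ suc)) (bit (f zero)))

count-≥2 : ∀ {m} (f : Fin m → Bool) i j → f i ≡ true → f j ≡ true → i ≢ j → 2 ≤ count f
count-≥2 f zero    zero    fi fj i≢j = ⊥-elim (i≢j ≡.refl)
count-≥2 f zero    (suc j) fi fj i≢j rewrite fi = s≤s (count-≥1 (f ∘ suc) j fj)
count-≥2 f (suc i) zero    fi fj i≢j rewrite fj = s≤s (count-≥1 (f ∘ suc) i fi)
count-≥2 f (suc i) (suc j) fi fj i≢j =
  ℕₚ.≤-trans (count-≥2 (f ∘ suc) i j fi fj (i≢j ∘ ≡.cong suc)) (ℕₚ.m≤n+m (count (f ∘ suc)) (bit (f zero)))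

∈-tabulate : ∀ {n} (f : Fin n → Bool) {j} → f j ≡ true → j ∈ tabulate f
∈-tabulate f {j} fj = Vecₚ.lookup⇒[]= j (tabulate f) (≡.trans (Vecₚ.lookup∘tabulate f j) fj)

Incident : ∀ {n m} → (Fin m → Arc n) → Fin n → Fin m → Set
Incident B w j = tail (B j) ≡ w ⊎ head (B j) ≡ w

leaf-arc-unique : ∀ {n m} (B : Fin m → Arc n) {R : Subset m} {w : Fin n} {i j : Fin m} →
  degree B R w ≡ 1 → i ∈ R → Incident B w i → j ∈ R → Incident B w j → i ≡ j
leaf-arc-unique {m = m} B {R} {w} {i} {j} deg i∈R inc-i j∈R inc-j with i Fin.≟ j
... | yes i≡j = i≡j
... | no  i≢j = ⊥-elim (ℕₚ.<-irrefl ≡.refl (≡.subst (2 ≤_) deg (two-arcs inc-i inc-j)))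
  where
  leaves enters : Fin m → Bool
  leaves k = does (k ∈? R) ∧ does (tail (B k) Fin.≟ w)
  enters k = does (k ∈? R) ∧ does (head (B k) Fin.≟ w)
  leaves-true : ∀ {k} → k ∈ R → tail (B k) ≡ w → leaves k ≡ true
  leaves-true {k} k∈R e = ≡.cong₂ _∧_ (dec-true (k ∈? R) k∈R) (dec-true (tail (B k) Fin.≟ w) e)
  enters-true : ∀ {k} → k ∈ R → head (B k) ≡ w → enters k ≡ true
  enters-true {k} k∈R e = ≡.cong₂ _∧_ (dec-true (k ∈? R) k∈R) (dec-true (head (B k) Fin.≟ w) e)
  two-arcs : Incident B w i → Incident B w j → 2 ≤ degree B R w
  two-arcs (inj₁ ti) (inj₁ tj) = ℕₚ.≤-trans
    (count-≥2 leaves i j (leaves-true i∈R ti) (leaves-true j∈R tj) i≢j) (ℕₚ.m≤m+n (count leaves) (count enters))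
  two-arcs (inj₁ ti) (inj₂ hj) = ℕₚ.+-mono-≤ (count-≥1 leaves i (leaves-true i∈R ti)) (count-≥1 enters j (enters-true j∈R hj))
  two-arcs (inj₂ hi) (inj₁ tj) = ℕₚ.+-mono-≤ (count-≥1 leaves j (leaves-true j∈R tj)) (count-≥1 enters i (enters-true i∈R hi))
  two-arcs (inj₂ hi) (inj₂ hj) = ℕₚ.≤-trans
    (count-≥2 enters i j (enters-true i∈R hi) (enters-true j∈R hj) i≢j) (ℕₚ.m≤n+m (count enters) (count leaves))

adj-sym : ∀ {n m} {B : Fin m → Arc n} {u w : Fin n} → Adj B u w → Adj B w u
adj-sym (k , inj₁ e) = k , inj₂ e
adj-sym (k , inj₂ e) = k , inj₁ e

-- A vertex test is closed if it is constant along the arcs of B, i.e. it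
-- describes a union of connected components of H.
Closed : ∀ {n m} → (Fin m → Arc n) → (Fin n → Bool) → Set
Closed B σ = ∀ {u w} → Adj B u w → σ u ≡ σ w

component-contains : ∀ {n m} {B : Fin m → Arc n} {v : Fin n} {S : Subset n} →
  IsComponentOf B v S → member S v ≡ true
component-contains {v = v} {S} comp = dec-true (v ∈? S) (Equivalence.from (comp v) ε)

component-avoids : ∀ {n m} {B : Fin m → Arc n} {u v : Fin n} {S : Subset n} →
  ¬ Conn B u v → IsComponentOf B v S → member S u ≡ false
component-avoids {u = u} {S = S} u≁v comp =
  dec-false (u ∈? S) (λ u∈S → u≁v (reverse adj-sym (Equivalence.to (comp u) u∈S)))

component-closed : ∀ {n m} {B : Fin m → Arc n} {v : Fin n} {S : Subset n} →
  IsComponentOf B v S → Closed B (member S)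
component-closed {S = S} comp {u} {w} u~w =
  does-⇔ (mk⇔ (λ u∈S → from (comp w) (to (comp u) u∈S ◅◅ (u~w ◅ ε)))
              (λ w∈S → from (comp u) (to (comp w) w∈S ◅◅ (adj-sym u~w ◅ ε))))
         (u ∈? S) (w ∈? S)
  where open Equivalence

module OrderedFieldFacts {c ℓ} (F : OrderedField c ℓ) where
  open OrderedField F hiding (zero)
  open IsStrictTotalOrder isStrictTotalOrder using (irrefl; <-resp-≈; asym; compare)
    renaming (trans to <-trans)
  open import Algebra.Properties.Ring ring using (-1*x≈-x)
  open import Algebra.Properties.Group +-group using (∙-cancelˡ; ⁻¹-injective; ε⁻¹≈ε; ⁻¹-involutive)
  open import Relation.Binary.Reasoning.Setoid setoid

  <⇒≉ : ∀ {a d} → a < d → ¬ (a ≈ d)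
  <⇒≉ a<d a≈d = irrefl a≈d a<d

  -- 1 is positive: if 1 < 0 then 0 < -1, hence 0 < (-1)(-1) = 1.
  0<1 : 0# < 1#
  0<1 with compare 0# 1#
  ... | tri< 0<1′ _ _ = 0<1′
  ... | tri≈ _ 0≈1 _ = ⊥-elim (0≉1 0≈1)
  ... | tri> _ _ 1<0 = ⊥-elim (asym 1<0 (proj₁ <-resp-≈ square≈1 (*-pos 0<-1 0<-1)))
    where
    0<-1 : 0# < (- 1#)
    0<-1 = proj₂ <-resp-≈ (-‿inverseʳ 1#) (proj₁ <-resp-≈ (+-identityˡ (- 1#)) (+-mono-< (- 1#) 1<0))
    square≈1 : - 1# * - 1# ≈ 1#
    square≈1 = trans (-1*x≈-x (- 1#)) (⁻¹-involutive 1#)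

  ^-pos : ∀ {β} → 0# < β → ∀ k → 0# < _^_ F β k
  ^-pos 0<β zero    = 0<1
  ^-pos 0<β (suc k) = *-pos 0<β (^-pos 0<β k)

  unit-coefficient : ∀ {a z d} → a ≈ 1# → a * z ≈ d → z ≈ d
  unit-coefficient {a} {z} {d} a≈1 az≈d = begin
    z      ≈⟨ *-identityˡ z ⟨
    1# * z ≈⟨ *-congʳ a≈1 ⟨
    a * z  ≈⟨ az≈d ⟩
    d      ∎

  nonzero-cancel : ∀ {a z} → ¬ (a ≈ 0#) → a * z ≈ 0# → z ≈ 0#
  nonzero-cancel {a} {z} a≉0 az≈0 with inverse a a≉0
  ... | a⁻¹ , aa⁻¹≈1 = begin
    z             ≈⟨ *-identityˡ z ⟨
    1# * z        ≈⟨ *-congʳ (trans (sym aa⁻¹≈1) (*-comm a a⁻¹)) ⟩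
    (a⁻¹ * a) * z ≈⟨ *-assoc a⁻¹ a z ⟩
    a⁻¹ * (a * z) ≈⟨ *-congˡ az≈0 ⟩
    a⁻¹ * 0#      ≈⟨ zeroʳ a⁻¹ ⟩
    0#            ∎

  -≈0⇒≈0 : ∀ {a} → - a ≈ 0# → a ≈ 0#
  -≈0⇒≈0 -a≈0 = ⁻¹-injective (trans -a≈0 (sym ε⁻¹≈ε))

  ≉-minus-pos : ∀ {a d} → 0# < d → ¬ (a ≈ a - d)
  ≉-minus-pos {a} {d} 0<d a≈a-d =
    <⇒≉ 0<d (sym (-≈0⇒≈0 (sym (∙-cancelˡ a 0# (- d) (trans (+-identityʳ a) a≈a-d)))))

  embed : ℕ → Carrier
  embed zero    = 0#
  embed (suc n) = 1# + embed n

  embed-suc-pos : ∀ n → 0# < embed (suc n)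
  embed-suc-pos zero    = proj₁ <-resp-≈ (sym (+-identityʳ 1#)) 0<1
  embed-suc-pos (suc n) = <-trans 0<1
    (proj₂ <-resp-≈ (+-identityˡ 1#)
      (proj₁ <-resp-≈ (+-comm (embed (suc n)) 1#) (+-mono-< 1# (embed-suc-pos n))))

  -- An ordered field has characteristic zero.
  embed-injective : ∀ a d → embed a ≈ embed d → a ≡ d
  embed-injective zero    zero    _ = ≡.refl
  embed-injective zero    (suc d) e = ⊥-elim (<⇒≉ (embed-suc-pos d) e)
  embed-injective (suc a) zero    e = ⊥-elim (<⇒≉ (embed-suc-pos a) (sym e))
  embed-injective (suc a) (suc d) e = ≡.cong suc (embed-injective a d (∙-cancelˡ 1# _ _ e))

-- Square matrices with a two-sided inverse; everything except
-- `block-count` holds verbatim over any commutative ring.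
module MatrixFacts {c ℓ} (F : OrderedField c ℓ) where
  open OrderedField F hiding (zero)
  open OrderedFieldFacts F using (embed; embed-injective)
  open import Algebra.Properties.Semiring.Sum semiring
    using (sum; ∑-comm; *-distribˡ-sum; *-distribʳ-sum; sum-cong-≋; sum-replicate-zero; sum-remove)
  open import Relation.Binary.Reasoning.Setoid setoid

  Matrix : ℕ → Set c
  Matrix m = Fin m → Fin m → Carrier

  if-true : ∀ {t} {a d : Carrier} → t ≡ true → (if t then a else d) ≈ a
  if-true ≡.refl = refl

  if-false : ∀ {t} {a d : Carrier} → t ≡ false → (if t then a else d) ≈ d
  if-false ≡.refl = refl

  sum-zero : ∀ {m} (f : Fin m → Carrier) → (∀ i → f i ≈ 0#) → sum f ≈ 0#
  sum-zero {m} f f≈0 = trans (sum-cong-≋ f≈0) (sum-replicate-zero m)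

  sum-single : ∀ {m} (f : Fin m → Carrier) (k : Fin m) → (∀ j → j ≢ k → f j ≈ 0#) → sum f ≈ f k
  sum-single {suc m} f k off-k = begin
    sum f                                ≈⟨ sum-remove {i = k} f ⟩
    f k + sum (f ∘ Fin.punchIn k)        ≈⟨ +-congˡ (sum-zero _ (λ j → off-k _ (Finₚ.punchInᵢ≢i k j))) ⟩
    f k + 0#                             ≈⟨ +-identityʳ (f k) ⟩
    f k                                  ∎

  I-diag : ∀ {m} (i : Fin m) → I F i i ≈ 1#
  I-diag i = if-true (dec-true (i Fin.≟ i) ≡.refl)

  I-apply : ∀ {m} (v : Fin m → Carrier) i → _·ᵥ_ F (I F) v i ≈ v i
  I-apply v i = begin
    _·ᵥ_ F (I F) v i ≈⟨ sum-single _ i (λ j j≢i → trans (*-congʳ (if-false (dec-false (i Fin.≟ j) (j≢i ∘ ≡.sym)))) (zeroˡ (v j))) ⟩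
    I F i i * v i    ≈⟨ *-congʳ (I-diag i) ⟩
    1# * v i         ≈⟨ *-identityˡ (v i) ⟩
    v i              ∎

  ·ᵥ-assoc : ∀ {m} (A M : Matrix m) (v : Fin m → Carrier) r →
    _·ᵥ_ F A (_·ᵥ_ F M v) r ≈ _·ᵥ_ F (_·_ F A M) v r
  ·ᵥ-assoc A M v r = begin
    sum (λ k → A r k * sum (λ j → M k j * v j))   ≈⟨ sum-cong-≋ (λ k → *-distribˡ-sum (A r k) (λ j → M k j * v j)) ⟩
    sum (λ k → sum (λ j → A r k * (M k j * v j))) ≈⟨ ∑-comm (λ k j → A r k * (M k j * v j)) ⟩
    sum (λ j → sum (λ k → A r k * (M k j * v j))) ≈⟨ sum-cong-≋ (λ j → sum-cong-≋ (λ k → *-assoc (A r k) (M k j) (v j))) ⟨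
    sum (λ j → sum (λ k → (A r k * M k j) * v j)) ≈⟨ sum-cong-≋ (λ j → *-distribʳ-sum (v j) (λ k → A r k * M k j)) ⟨
    sum (λ j → _·_ F A M r j * v j)               ∎

  ·ᵥ-congˡ : ∀ {m} {A A′ : Matrix m} (v : Fin m → Carrier) →
    (∀ i j → A i j ≈ A′ i j) → ∀ r → _·ᵥ_ F A v r ≈ _·ᵥ_ F A′ v r
  ·ᵥ-congˡ v A≈A′ r = sum-cong-≋ (λ j → *-congʳ (A≈A′ r j))

  inverse-solves : ∀ {m} (A M : Matrix m) → IsInverse F M A →
    ∀ v r → _·ᵥ_ F A (_·ᵥ_ F M v) r ≈ v r
  inverse-solves A M (AM≈I , _) v r =
    trans (·ᵥ-assoc A M v r) (trans (·ᵥ-congˡ v AM≈I r) (I-apply v r))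

  inverse-kernel : ∀ {m} (A M : Matrix m) → IsInverse F M A →
    ∀ y → (∀ r → _·ᵥ_ F A y r ≈ 0#) → ∀ k → y k ≈ 0#
  inverse-kernel A M (_ , MA≈I) y Ay≈0 k = begin
    y k                              ≈⟨ I-apply y k ⟨
    _·ᵥ_ F (I F) y k                 ≈⟨ ·ᵥ-congˡ y MA≈I k ⟨
    _·ᵥ_ F (_·_ F M A) y k           ≈⟨ ·ᵥ-assoc M A y k ⟨
    sum (λ r → M k r * _·ᵥ_ F A y r) ≈⟨ sum-zero _ (λ r → trans (*-congˡ (Ay≈0 r)) (zeroʳ (M k r))) ⟩
    0#                               ∎

  BlockDiagonal : ∀ {m} → Matrix m → (Fin m → Bool) → (Fin m → Bool) → Set ℓ
  BlockDiagonal A P Q = ∀ r k → P k ≢ Q r → A r k ≈ 0#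

  -- The term-wise identity behind trace(D_P M A) = trace(D_Q A M).
  indicator-swap : ∀ (s t : Bool) {a d} → (s ≢ t → a ≈ 0#) →
    indicator F s 1# * (d * a) ≈ indicator F t 1# * (a * d)
  indicator-swap true  true  {a} {d} _ = *-congˡ (*-comm d a)
  indicator-swap false false         _ = trans (zeroˡ _) (sym (zeroˡ _))
  indicator-swap true  false {a} {d} off =
    trans (*-congˡ (trans (*-congˡ (off λ ())) (zeroʳ d))) (trans (zeroʳ _) (sym (zeroˡ _)))
  indicator-swap false true  {a} {d} off =
    trans (zeroˡ _) (sym (trans (*-congˡ (trans (*-congʳ (off λ ())) (zeroˡ d))) (zeroʳ _)))

  sum-indicator : ∀ {m} (P : Fin m → Bool) → sum (λ k → indicator F (P k) 1#) ≈ embed (count P)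
  sum-indicator {zero}  P = refl
  sum-indicator {suc m} P with P zero
  ... | true  = +-congˡ (sum-indicator (P ∘ suc))
  ... | false = trans (+-identityˡ _) (sum-indicator (P ∘ suc))

  block-count : ∀ {m} (A M : Matrix m) → IsInverse F M A →
    ∀ P Q → BlockDiagonal A P Q → count P ≡ count Q
  block-count A M (AM≈I , MA≈I) P Q blocks = embed-injective _ _ (begin
    embed (count P)                                         ≈⟨ sum-indicator P ⟨
    sum (λ k → [ P k ])                                     ≈⟨ sum-cong-≋ (λ k → diagonal [ P k ] (trans (MA≈I k k) (I-diag k))) ⟩
    sum (λ k → [ P k ] * sum (λ r → M k r * A r k))         ≈⟨ sum-cong-≋ (λ k → *-distribˡ-sum [ P k ] (λ r → M k r * A r k)) ⟩
    sum (λ k → sum (λ r → [ P k ] * (M k r * A r k)))       ≈⟨ ∑-comm (λ k r → [ P k ] * (M k r * A r k)) ⟩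
    sum (λ r → sum (λ k → [ P k ] * (M k r * A r k)))       ≈⟨ sum-cong-≋ (λ r → sum-cong-≋ (λ k → indicator-swap (P k) (Q r) (blocks r k))) ⟩
    sum (λ r → sum (λ k → [ Q r ] * (A r k * M k r)))       ≈⟨ sum-cong-≋ (λ r → *-distribˡ-sum [ Q r ] (λ k → A r k * M k r)) ⟨
    sum (λ r → [ Q r ] * sum (λ k → A r k * M k r))         ≈⟨ sum-cong-≋ (λ r → diagonal [ Q r ] (trans (AM≈I r r) (I-diag r))) ⟨
    sum (λ r → [ Q r ])                                     ≈⟨ sum-indicator Q ⟩
    embed (count Q)                                         ∎)
    where
    [_] : Bool → Carrier
    [ t ] = indicator F t 1#
    diagonal : ∀ a {d} → d ≈ 1# → a ≈ a * d
    diagonal a d≈1 = trans (sym (*-identityʳ a)) (*-congˡ (sym d≈1))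

  block-support : ∀ {m} (A M : Matrix m) → IsInverse F M A →
    ∀ P Q → BlockDiagonal A P Q →
    ∀ v → (∀ r → Q r ≡ true → v r ≈ 0#) → ∀ k → P k ≡ true → _·ᵥ_ F M v k ≈ 0#
  block-support {m} A M inv P Q blocks v v-on-Q k Pk = begin
    x k ≈⟨ if-true Pk ⟨
    y k ≈⟨ inverse-kernel A M inv y Ay≈0 k ⟩
    0#  ∎
    where
    -- x = M v, and y is x with its entries outside the block P set to 0;
    -- A y = 0 by the block structure, hence y = 0.
    x y : Fin m → Carrier
    x = _·ᵥ_ F M v
    y j = indicator F (P j) (x j)
    masked-term : ∀ (s t : Bool) {a z} → (s ≢ t → a ≈ 0#) → a * indicator F s z ≈ indicator F t (a * z)
    masked-term true  true  _   = refl
    masked-term false false _   = zeroʳ _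
    masked-term true  false off = trans (*-congʳ (off λ ())) (zeroˡ _)
    masked-term false true  off = trans (zeroʳ _) (sym (trans (*-congʳ (off λ ())) (zeroˡ _)))
    sum-masked : ∀ t (f : Fin m → Carrier) → sum (λ j → indicator F t (f j)) ≈ indicator F t (sum f)
    sum-masked true  f = refl
    sum-masked false f = sum-zero {m} (λ _ → 0#) (λ _ → refl)
    vanishes-on : ∀ t {z} → (t ≡ true → z ≈ 0#) → indicator F t z ≈ 0#
    vanishes-on true  z≈0 = z≈0 ≡.refl
    vanishes-on false _   = refl
    Ay≈0 : ∀ r → _·ᵥ_ F A y r ≈ 0#
    Ay≈0 r = begin
      _·ᵥ_ F A y r                                ≈⟨ sum-cong-≋ (λ j → masked-term (P j) (Q r) (blocks r j)) ⟩
      sum (λ j → indicator F (Q r) (A r j * x j)) ≈⟨ sum-masked (Q r) _ ⟩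
      indicator F (Q r) (_·ᵥ_ F A x r)            ≈⟨ vanishes-on (Q r) (λ Qr → trans (inverse-solves A M inv v r) (v-on-Q r Qr)) ⟩
      0#                                          ∎

-- Row inject₁ u of A_B carries the flow equation of vertex u and row fromℕ n
-- the extra equation Σ x₁ⱼ = 1, which belongs with vertex 1.  The rows of a
-- vertex test σ are those of its vertices, plus the extra row if 1 passes σ.
rowsOfView : ∀ {p} → (Fin (suc p) → Bool) → {r : Fin (suc (suc p))} → View r → Bool
rowsOfView σ ‵fromℕ          = σ zero
rowsOfView σ (‵inj₁ {i = u} _) = σ u

rowsOf : ∀ {p} → (Fin (suc p) → Bool) → Fin (suc (suc p)) → Bool
rowsOf σ r = rowsOfView σ (view r)

count-rowsOf : ∀ {p} (σ : Fin (suc p) → Bool) → count (rowsOf σ) ≡ count σ ℕ.+ bit (σ zero)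
count-rowsOf {p} σ = ≡.trans (count-last (rowsOf σ)) (≡.cong₂ ℕ._+_
  (count-cong (λ u → ≡.cong (rowsOfView σ) (view-inject₁ u)))
  (≡.cong (bit ∘ rowsOfView σ) (view-fromℕ (suc p))))

module ConstraintMatrix {c ℓ} (F : OrderedField c ℓ) {p : ℕ}
                        (β : OrderedField.Carrier F) (B : Fin (suc (suc p)) → Arc (suc p)) where
  open OrderedField F hiding (zero)
  open OrderedFieldFacts F
  open MatrixFacts F
  open import Algebra.Properties.Group +-group using (ε⁻¹≈ε)

  A : Matrix (suc (suc p))
  A = A[_] F β B

  b : Fin (suc (suc p)) → Carrier
  b = bvec F β

  extra : Fin (suc (suc p))
  extra = fromℕ (suc p)

  not-extra : ∀ (w : Fin (suc p)) → does (inject₁ w Fin.≟ extra) ≡ false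
  not-extra w = dec-false (inject₁ w Fin.≟ extra) (Finₚ.fromℕ≢inject₁ ∘ ≡.sym)

  endpoint-yes : ∀ {w u : Fin (suc p)} {a} → w ≡ u → indicator F (does (inject₁ w Fin.≟ inject₁ u)) a ≈ a
  endpoint-yes {w} {u} w≡u = if-true (dec-true (inject₁ w Fin.≟ inject₁ u) (≡.cong inject₁ w≡u))

  endpoint-no : ∀ {w u : Fin (suc p)} {a} → w ≢ u → indicator F (does (inject₁ w Fin.≟ inject₁ u)) a ≈ 0#
  endpoint-no {w} {u} w≢u = if-false (dec-false (inject₁ w Fin.≟ inject₁ u) (w≢u ∘ Finₚ.inject₁-injective))

  A-vertex : ∀ w k → A (inject₁ w) k ≈
    indicator F (does (inject₁ w Fin.≟ inject₁ (tail (B k)))) 1#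
      - indicator F (does (inject₁ w Fin.≟ inject₁ (head (B k)))) β
  A-vertex w k = if-false (not-extra w)

  A-vertex-zero : ∀ w k → w ≢ tail (B k) → w ≢ head (B k) → A (inject₁ w) k ≈ 0#
  A-vertex-zero w k w≢t w≢h =
    trans (A-vertex w k) (trans (+-cong (endpoint-no w≢t) (-‿cong (endpoint-no w≢h))) (trans (+-congˡ ε⁻¹≈ε) (+-identityʳ 0#)))

  A-vertex-tail : ∀ w k → w ≡ tail (B k) → w ≢ head (B k) → A (inject₁ w) k ≈ 1#
  A-vertex-tail w k w≡t w≢h =
    trans (A-vertex w k) (trans (+-cong (endpoint-yes w≡t) (-‿cong (endpoint-no w≢h))) (trans (+-congˡ ε⁻¹≈ε) (+-identityʳ 1#)))

  A-vertex-head : ∀ w k → w ≢ tail (B k) → w ≡ head (B k) → A (inject₁ w) k ≈ - β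
  A-vertex-head w k w≢t w≡h =
    trans (A-vertex w k) (trans (+-cong (endpoint-no w≢t) (-‿cong (endpoint-yes w≡h))) (+-identityˡ (- β)))

  A-extra : ∀ k → A extra k ≈ indicator F (does (tail (B k) Fin.≟ zero)) 1#
  A-extra k = if-true (dec-true (extra Fin.≟ extra) ≡.refl)

  A-extra-from1 : ∀ k → tail (B k) ≡ zero → A extra k ≈ 1#
  A-extra-from1 k t≡1 = trans (A-extra k) (if-true (dec-true (tail (B k) Fin.≟ zero) t≡1))

  A-extra-other : ∀ k → tail (B k) ≢ zero → A extra k ≈ 0#
  A-extra-other k t≢1 = trans (A-extra k) (if-false (dec-false (tail (B k) Fin.≟ zero) t≢1))

  b-extra : b extra ≈ 1#
  b-extra = if-true (dec-true (extra Fin.≟ extra) ≡.refl)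

  b-vertex1 : b zero ≈ 1# - _^_ F β (suc p)
  b-vertex1 = trans (if-false {a = 1#} (not-extra zero))
                    (if-true {a = 1# - _^_ F β (suc p)} {d = 0#} (dec-true (zero {suc p} Fin.≟ zero) ≡.refl))

  b-vertex-other : ∀ w → w ≢ zero → b (inject₁ w) ≈ 0#
  b-vertex-other w w≢1 = trans (if-false (not-extra w))
    (if-false (dec-false (inject₁ w Fin.≟ zero) (w≢1 ∘ Finₚ.inject₁-injective)))

  arcsOf : (Fin (suc p) → Bool) → Fin (suc (suc p)) → Bool
  arcsOf σ k = σ (tail (B k))

  block-diagonal : ∀ σ → Closed B σ → BlockDiagonal A (arcsOf σ) (rowsOf σ)
  block-diagonal σ closed r k apart with view r
  ... | ‵fromℕ     = A-extra-other k (apart ∘ ≡.cong σ)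
  ... | ‵inject₁ w = A-vertex-zero w k (apart ∘ ≡.cong σ ∘ ≡.sym)
                       (λ w≡h → apart (≡.trans (closed (k , inj₁ ≡.refl)) (≡.cong σ (≡.sym w≡h))))

  b-off-vertex1 : ∀ σ → σ zero ≡ false → ∀ r → rowsOf σ r ≡ true → b r ≈ 0#
  b-off-vertex1 σ σ1 r σr with view r
  ... | ‵fromℕ     = ⊥-elim (not-¬ σr σ1)
  ... | ‵inject₁ w = b-vertex-other w (λ w≡1 → not-¬ σr (≡.trans (≡.cong σ w≡1) σ1))

  arc-count : ∀ M → IsInverse F M A → ∀ σ → Closed B σ →
    count (arcsOf σ) ≡ count σ ℕ.+ bit (σ zero)
  arc-count M inv σ closed =
    ≡.trans (block-count A M inv (arcsOf σ) (rowsOf σ) (block-diagonal σ closed)) (count-rowsOf σ)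

  component-arc-count : ∀ M → IsInverse F M A → ∀ {v T} → IsComponentOf B v T →
    count (arcsIn B T) ≡ ∣ T ∣ ℕ.+ bit (member T zero)
  component-arc-count M inv {T = T} comp =
    ≡.trans (arc-count M inv (member T) (component-closed comp))
            (≡.cong (ℕ._+ bit (member T zero)) (count-∈ T))

  -- The two row equations at a leaf w with arc k force any value z of
  -- that arc to be 0: row w alone if w ≠ 1, rows w and the extra row if w = 1.
  leaf-equations : ∀ {k} → 0# < β → tail (B k) ≢ head (B k) →
    ∀ w → Incident B w k → Dec (w ≡ zero) → ∀ {z} →
    A (inject₁ w) k * z ≈ b (inject₁ w) → (w ≡ zero → A extra k * z ≈ 1#) → z ≈ 0#
  leaf-equations {k} 0<β loop-free w (inj₁ t≡w) (no w≢1) vertex-row _ =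
    unit-coefficient (A-vertex-tail w k (≡.sym t≡w) (loop-free ∘ ≡.trans t≡w))
                     (trans vertex-row (b-vertex-other w w≢1))
  leaf-equations {k} 0<β loop-free w (inj₂ h≡w) (no w≢1) vertex-row _ =
    nonzero-cancel (λ -β≈0 → <⇒≉ 0<β (sym (-≈0⇒≈0 -β≈0)))
      (trans (*-congʳ (sym (A-vertex-head w k (λ w≡t → loop-free (≡.trans (≡.sym w≡t) (≡.sym h≡w))) (≡.sym h≡w))))
             (trans vertex-row (b-vertex-other w w≢1)))
  leaf-equations {k} 0<β loop-free .zero (inj₁ t≡1) (yes ≡.refl) {z} vertex-row extra-row =
    ⊥-elim (≉-minus-pos (^-pos 0<β (suc p)) (trans (sym z≈1) z≈1-βⁿ))
    where
    z≈1 : z ≈ 1#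
    z≈1 = unit-coefficient (A-extra-from1 k t≡1) (extra-row ≡.refl)
    z≈1-βⁿ : z ≈ 1# - _^_ F β (suc p)
    z≈1-βⁿ = unit-coefficient (A-vertex-tail zero k (≡.sym t≡1) (loop-free ∘ ≡.trans t≡1))
                              (trans vertex-row b-vertex1)
  leaf-equations {k} 0<β loop-free .zero (inj₂ h≡1) (yes ≡.refl) vertex-row extra-row =
    ⊥-elim (0≉1 (trans (sym (zeroˡ _)) (trans (*-congʳ (sym (A-extra-other k t≢1))) (extra-row ≡.refl))))
    where
    t≢1 : tail (B k) ≢ zero
    t≢1 t≡1 = loop-free (≡.trans t≡1 (≡.sym h≡1))

  module Solution (M : Matrix (suc (suc p))) (inv : IsInverse F M A) where
    x : Fin (suc (suc p)) → Carrier
    x = _·ᵥ_ F M b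

    Supports : Subset (suc (suc p)) → Set ℓ
    Supports R = ∀ j → j ∉ R → x j ≈ 0#

    vanishes-off-vertex1 : ∀ σ → Closed B σ → σ zero ≡ false → ∀ k → arcsOf σ k ≡ true → x k ≈ 0#
    vanishes-off-vertex1 σ closed σ1 =
      block-support A M inv (arcsOf σ) (rowsOf σ) (block-diagonal σ closed) b (b-off-vertex1 σ σ1)

    vanishes-off-H₁ : ∀ {S₁} → IsComponentOf B zero S₁ → Supports (tabulate (arcsIn B S₁))
    vanishes-off-H₁ {S₁} comp₁ j j∉H₁ =
      vanishes-off-vertex1 (not ∘ member S₁) (≡.cong not ∘ component-closed comp₁)
        (≡.cong not (component-contains comp₁)) j (≡.cong not (¬-not (j∉H₁ ∘ ∈-tabulate (arcsIn B S₁))))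

    leaf-row : ∀ {R w k} → Supports R → degree B R w ≡ 1 → k ∈ R → Incident B w k →
      ∀ r → (∀ j → ¬ Incident B w j → A r j ≈ 0#) → A r k * x k ≈ b r
    leaf-row {R} {w} {k} supp deg k∈R inc-k r off-w =
      trans (sym (sum-single _ k other-terms)) (inverse-solves A M inv b r)
      where
      other-terms : ∀ j → j ≢ k → A r j * x j ≈ 0#
      other-terms j j≢k with j ∈? R
      ... | no  j∉R = trans (*-congˡ (supp j j∉R)) (zeroʳ _)
      ... | yes j∈R = trans (*-congʳ (off-w j (j≢k ∘ λ inc-j → leaf-arc-unique B deg j∈R inc-j k∈R inc-k))) (zeroˡ _)

    leaf-arc-zero : 0# < β → (∀ j → tail (B j) ≢ head (B j)) →
      ∀ {R w k} → Supports R → degree B R w ≡ 1 → k ∈ R → Incident B w k → x k ≈ 0#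
    leaf-arc-zero 0<β loop-free {R} {w} {k} supp deg k∈R inc-k =
      leaf-equations 0<β (loop-free k) w inc-k (w Fin.≟ zero)
        (leaf-row supp deg k∈R inc-k (inject₁ w)
          (λ j ¬inc → A-vertex-zero w j (¬inc ∘ inj₁ ∘ ≡.sym) (¬inc ∘ inj₂ ∘ ≡.sym)))
        (λ w≡1 → trans (leaf-row supp deg k∈R inc-k extra
          (λ j ¬inc → A-extra-other j (λ t≡1 → ¬inc (inj₁ (≡.trans t≡1 (≡.sym w≡1)))))) b-extra)

    leaf-step-supports : 0# < β → (∀ j → tail (B j) ≢ head (B j)) →
      ∀ {R R′} → LeafStep B R R′ → Supports R → Supports R′
    leaf-step-supports 0<β loop-free {R} (remove w k deg k∈R inc-k R′≡R-k) supp j j∉R′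
      with j ∈? R | j Fin.≟ k
    ... | no  j∉R | _          = supp j j∉R
    ... | yes _   | yes ≡.refl = leaf-arc-zero 0<β loop-free supp deg k∈R inc-k
    ... | yes j∈R | no  j≢k    = ⊥-elim (j∉R′ (Equivalence.from (R′≡R-k j) (j∈R , j≢k)))

    peeling-supports : 0# < β → (∀ j → tail (B j) ≢ head (B j)) →
      ∀ {R R′} → Star (LeafStep B) R R′ → Supports R → Supports R′
    peeling-supports 0<β loop-free ε            supp = supp
    peeling-supports 0<β loop-free (step ◅ steps) supp =
      peeling-supports 0<β loop-free steps (leaf-step-supports 0<β loop-free step supp)

lemma4 : ∀ {c ℓ} (F : OrderedField c ℓ) (p : ℕ) →
    let open OrderedField F in
    (β : Carrier) → 0# < β → β < 1# →
    (E : List (Arc (suc p))) → Unique E →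
    (∀ {e} → e ∈ₗ E → tail e ≢ head e) →
    (B : Fin (suc (suc p)) → Arc (suc p)) → Injective _≡_ _≡_ B →
    (∀ k → B k ∈ₗ E) →
    (M : Fin (suc (suc p)) → Fin (suc (suc p)) → Carrier) →
    IsInverse F M (A[_] F β B) →
    (S₁ : Subset (suc p)) → IsComponentOf B vertex1 S₁ →
    (count (arcsIn B S₁) ≡ suc ∣ S₁ ∣)
    × (∀ v T → ¬ Conn B vertex1 v → IsComponentOf B v T →
    count (arcsIn B T) ≡ ∣ T ∣)
    × (∀ Rρ → IsRho B (tabulate (arcsIn B S₁)) Rρ →
    ∀ k → k ∉ Rρ → _·ᵥ_ F M (bvec F β) k ≈ 0#)
lemma4 F p β 0<β _ E _ loop-free-E B _ B⊆E M inv S₁ comp₁ = part-i₁ , part-iₖ , part-ii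
  where
  open ConstraintMatrix F β B
  open Solution M inv

  loop-free : ∀ j → tail (B j) ≢ head (B j)
  loop-free j = loop-free-E (B⊆E j)

  part-i₁ : count (arcsIn B S₁) ≡ suc ∣ S₁ ∣
  part-i₁ = ≡.trans (component-arc-count M inv comp₁)
    (≡.trans (≡.cong (λ t → ∣ S₁ ∣ ℕ.+ bit t) (component-contains comp₁)) (ℕₚ.+-comm ∣ S₁ ∣ 1))

  part-iₖ : ∀ v T → ¬ Conn B vertex1 v → IsComponentOf B v T → count (arcsIn B T) ≡ ∣ T ∣
  part-iₖ v T 1≁v compT = ≡.trans (component-arc-count M inv compT)
    (≡.trans (≡.cong (λ t → ∣ T ∣ ℕ.+ bit t) (component-avoids 1≁v compT)) (ℕₚ.+-identityʳ ∣ T ∣))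

  part-ii : ∀ Rρ → IsRho B (tabulate (arcsIn B S₁)) Rρ → Supports Rρ
  part-ii Rρ (peeling , _) = peeling-supports 0<β loop-free peeling (vanishes-off-H₁ comp₁)
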